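{- A vector in $\mathbb{Z}^3$ is contained in a $3$-dimensional icube in $\mathbb{Z}^3$ if and only if its Euclidean length is an integer.
   Context: A $3$-dimensional icube in $\mathbb{Z}^3$ is a triple $(u,v,w)$ of nonzero vectors in $\mathbb{Z}^3$ that are pairwise orthogonal and have the same Euclidean length. A vector is contained in the icube if it is one of $u,v,w$. Vectors are nonzero. -}

module Defs where

open import Data.Integer using (ℤ; +_; _+_; _*_)
open import Data.Nat using (ℕ)
open import Data.Product using (_×_; _,_; ∃-syntax)
open import Data.Sum using (_⊎_)
open import Relation.Binary.PropositionalEquality using (_≡_; _≢_)
open import Relation.Nullary using (¬_)

ℤ³ : Set
ℤ³ = ℤ × ℤ × ℤ

𝟎 : ℤ³
𝟎 = (+ 0 , + 0 , + 0)

_·_ : ℤ³ → ℤ³ → ℤ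
(a₁ , a₂ , a₃) · (b₁ , b₂ , b₃) = a₁ * b₁ + a₂ * b₂ + a₃ * b₃

‖_‖² : ℤ³ → ℤ
‖ v ‖² = v · v

-- a 3-dimensional icube: triple of nonzero, pairwise orthogonal vectors of equal length
-- (equal Euclidean length ⇔ equal squared length, lengths being nonnegative)
record IsIcube (u v w : ℤ³) : Set where
  field
    u≢0 : u ≢ 𝟎
    v≢0 : v ≢ 𝟎
    w≢0 : w ≢ 𝟎
    u⊥v : u · v ≡ + 0
    u⊥w : u · w ≡ + 0
    v⊥w : v · w ≡ + 0
    ‖u‖≡‖v‖ : ‖ u ‖² ≡ ‖ v ‖²
    ‖u‖≡‖w‖ : ‖ u ‖² ≡ ‖ w ‖²

InSomeIcube : ℤ³ → Set
InSomeIcube x = ∃[ u ] ∃[ v ] ∃[ w ] (IsIcube u v w × (x ≡ u ⊎ x ≡ v ⊎ x ≡ w))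

HasIntegerLength : ℤ³ → Set
HasIntegerLength x = ∃[ n ] (‖ x ‖² ≡ (+ n) * (+ n))

-- For an icube u, v, w with N = ‖u‖², the Gram determinant gives det(u, v, w)² = N³, and a natural
-- number whose cube is a square is itself a square. Conversely, every Pythagorean quadruple
-- a² + b² + c² = d² is, up to swapping coordinates, m times the first row of the (norm-scaled) rotation
-- matrix of an integer quaternion q, with d = m |q|². This follows by descent on d along the map
-- (a, b, c, d) ↦ (d − s + a, d − s + b, d − s + c, 2d − s), s = a + b + c, which preserves Pythagorean
-- quadruples, strictly decreases d unless two legs vanish, and is mirrored by a linear substitution on
-- quaternions. The three rows of that matrix, scaled by m, form an icube.
module Submission where

open import Defs
open import Data.Product using (_×_; _,_; ∃-syntax; proj₁; proj₂)
open import Data.Sum using (_⊎_; inj₁; inj₂; [_,_]′)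
open import Data.List using (_∷_; [])
open import Function using (_∘_)
open import Function.Bundles using (_⇔_; mk⇔)
open import Relation.Binary.PropositionalEquality

module ℕ-Squares where

  open import Data.Nat
  open import Data.Nat.Properties
  open import Data.Nat.Tactic.RingSolver using (solve; solve-∀)
  open import Data.Nat.Divisibility using (_∣_; divides; ∣-refl)
  open import Data.Nat.DivMod using (_/_; m/n*n≡m)
  open import Data.Nat.GCD using (gcd; gcd[m,n]∣m; gcd[m,n]∣n; gcd[m,n]≢0)
  open import Data.Nat.Coprimality using (coprime-/gcd; coprime-divisor)
  open import Relation.Nullary using (yes; no)

  m*m<n*n⇒m<n : ∀ {m n} → m * m < n * n → m < n
  m*m<n*n⇒m<n lt = ≰⇒> λ n≤m → <⇒≱ lt (*-mono-≤ n≤m n≤m)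

  m*m≤n*n⇒m≤n : ∀ {m n} → m * m ≤ n * n → m ≤ n
  m*m≤n*n⇒m≤n le = ≮⇒≥ λ n<m → <⇒≱ (*-mono-< n<m n<m) le

  m*m≡n*n⇒m≡n : ∀ {m n} → m * m ≡ n * n → m ≡ n
  m*m≡n*n⇒m≡n eq = ≤-antisym (m*m≤n*n⇒m≤n (≤-reflexive eq)) (m*m≤n*n⇒m≤n (≤-reflexive (sym eq)))

  m*n>0 : ∀ {m n} → m ≢ 0 → n ≢ 0 → 0 < m * n
  m*n>0 m≢0 n≢0 = *-mono-< (n≢0⇒n>0 m≢0) (n≢0⇒n>0 n≢0)

  OnAxis : ℕ → ℕ → ℕ → ℕ → Set
  OnAxis a b c d = (a ≡ d × b ≡ 0 × c ≡ 0) ⊎ (a ≡ 0 × b ≡ d × c ≡ 0) ⊎ (a ≡ 0 × b ≡ 0 × c ≡ d)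

  OnAxis⊎products>0 : ∀ a b c d → a * a + b * b + c * c ≡ d * d → OnAxis a b c d ⊎ 0 < a * b + b * c + c * a
  OnAxis⊎products>0 a b c d eq with a ≟ 0 | b ≟ 0 | c ≟ 0
  ... | _ | yes refl | yes refl = inj₁ (inj₁ (m*m≡n*n⇒m≡n (trans (sym (trans (+-identityʳ _) (+-identityʳ _))) eq) , refl , refl))
  ... | yes refl | _ | yes refl = inj₁ (inj₂ (inj₁ (refl , m*m≡n*n⇒m≡n (trans (sym (+-identityʳ _)) eq) , refl)))
  ... | yes refl | yes refl | _ = inj₁ (inj₂ (inj₂ (refl , refl , m*m≡n*n⇒m≡n eq)))
  ... | no a≢0 | no b≢0 | _     = inj₂ (<-≤-trans (m*n>0 a≢0 b≢0) (≤-trans (m≤m+n _ _) (m≤m+n _ _)))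
  ... | yes _ | no b≢0 | no c≢0 = inj₂ (<-≤-trans (m*n>0 b≢0 c≢0) (≤-trans (m≤n+m _ (a * b)) (m≤m+n _ _)))
  ... | no a≢0 | yes _ | no c≢0 = inj₂ (<-≤-trans (m*n>0 c≢0 a≢0) (m≤n+m _ _))

  2mn≤m²+n² : ∀ m n → 2 * (m * n) ≤ m * m + n * n
  2mn≤m²+n² m n with ≤-total m n
  ... | inj₁ m≤n with m≤n⇒∃[o]m+o≡n m≤n
  ...   | o , refl = ≤-trans (m≤m+n _ (o * o)) (≤-reflexive (solve (m ∷ o ∷ [])))
  2mn≤m²+n² m n | inj₂ n≤m with m≤n⇒∃[o]m+o≡n n≤m
  ...   | o , refl = ≤-trans (m≤m+n _ (o * o)) (≤-reflexive (solve (n ∷ o ∷ [])))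

  square-of-sum : ∀ a b c → (a + b + c) * (a + b + c) ≡ (a * a + b * b + c * c) + 2 * (a * b + b * c + c * a)
  square-of-sum = solve-∀

  barning-bounds : ∀ a b c d → a * a + b * b + c * c ≡ d * d → 0 < a * b + b * c + c * a →
                   d < a + b + c × a + b + c ≤ d + d
  barning-bounds a b c d eq P>0 = m*m<n*n⇒m<n lower , m*m≤n*n⇒m≤n upper
    where
    open ≤-Reasoning
    lower : d * d < (a + b + c) * (a + b + c)
    lower = begin-strict
      d * d                                           <⟨ m<m+n (d * d) (*-monoʳ-< 2 P>0) ⟩
      d * d + 2 * (a * b + b * c + c * a)             ≡⟨ cong (_+ 2 * (a * b + b * c + c * a)) eq ⟨
      (a * a + b * b + c * c) + 2 * (a * b + b * c + c * a) ≡⟨ square-of-sum a b c ⟨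
      (a + b + c) * (a + b + c)                       ∎
    upper : (a + b + c) * (a + b + c) ≤ (d + d) * (d + d)
    upper = begin
      (a + b + c) * (a + b + c)
        ≡⟨ square-of-sum a b c ⟩
      (a * a + b * b + c * c) + 2 * (a * b + b * c + c * a)
        ≡⟨ cong ((a * a + b * b + c * c) +_) (solve (a ∷ b ∷ c ∷ [])) ⟩
      (a * a + b * b + c * c) + (2 * (a * b) + 2 * (b * c) + 2 * (c * a))
        ≤⟨ +-monoʳ-≤ (a * a + b * b + c * c) (+-mono-≤ (+-mono-≤ (2mn≤m²+n² a b) (2mn≤m²+n² b c)) (2mn≤m²+n² c a)) ⟩
      (a * a + b * b + c * c) + ((a * a + b * b) + (b * b + c * c) + (c * c + a * a))
        ≡⟨ solve (a ∷ b ∷ c ∷ []) ⟩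
      3 * (a * a + b * b + c * c)
        ≡⟨ cong (3 *_) eq ⟩
      3 * (d * d)
        ≤⟨ m≤m+n (3 * (d * d)) (d * d) ⟩
      3 * (d * d) + d * d
        ≡⟨ solve (d ∷ []) ⟩
      (d + d) * (d + d) ∎

  private
    square-of-product : ∀ x y → (x * y) * (x * y) ≡ x * x * (y * y)
    square-of-product = solve-∀

    cube-of-product : ∀ x y → (x * y) * ((x * y) * (x * y)) ≡ x * (x * x * y) * (y * y)
    cube-of-product = solve-∀

    -- With g = gcd n m, n = b g and m = a g give a² = b³ g; so b ∣ a², hence b ∣ a by coprimality, and b = 1.
    m*m≡n*[n*n]⇒n≡k*k : ∀ m n .{{_ : NonZero (gcd n m)}} → m * m ≡ n * (n * n) → ∃[ k ] n ≡ k * k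
    m*m≡n*[n*n]⇒n≡k*k m n eq = a , n≡a*a
      where
      g = gcd n m
      a = m / g
      b = n / g
      bg≡n : b * g ≡ n
      bg≡n = m/n*n≡m (gcd[m,n]∣m n m)
      ag≡m : a * g ≡ m
      ag≡m = m/n*n≡m (gcd[m,n]∣n n m)
      instance
        g*g≢0 : NonZero (g * g)
        g*g≢0 = m*n≢0 g g
      a*a≡b*[b*b*g] : a * a ≡ b * (b * b * g)
      a*a≡b*[b*b*g] = *-cancelʳ-≡ (a * a) (b * (b * b * g)) (g * g) (begin
        a * a * (g * g)         ≡⟨ square-of-product a g ⟨
        (a * g) * (a * g)       ≡⟨ cong₂ _*_ ag≡m ag≡m ⟩
        m * m                   ≡⟨ eq ⟩
        n * (n * n)             ≡⟨ cong (λ x → x * (x * x)) bg≡n ⟨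
        (b * g) * ((b * g) * (b * g)) ≡⟨ cube-of-product b g ⟩
        b * (b * b * g) * (g * g) ∎)
        where open ≡-Reasoning
      b∣a : b ∣ a
      b∣a = coprime-divisor (coprime-/gcd n m) (divides (b * b * g) (trans a*a≡b*[b*b*g] (*-comm b _)))
      b≡1 : b ≡ 1
      b≡1 = coprime-/gcd n m (∣-refl , b∣a)
      n≡a*a : n ≡ a * a
      n≡a*a = begin
        n                 ≡⟨ bg≡n ⟨
        b * g             ≡⟨ cong (_* g) b≡1 ⟩
        1 * g             ≡⟨ *-identityˡ (1 * g) ⟨
        1 * (1 * g)       ≡⟨ cong (λ x → x * (x * x * g)) b≡1 ⟨
        b * (b * b * g)   ≡⟨ a*a≡b*[b*b*g] ⟨
        a * a             ∎
        where open ≡-Reasoning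

  m*m≡n*[n*n]⇒square : ∀ m n → m * m ≡ n * (n * n) → ∃[ k ] n ≡ k * k
  m*m≡n*[n*n]⇒square m zero    eq = 0 , refl
  m*m≡n*[n*n]⇒square m (suc n) eq = m*m≡n*[n*n]⇒n≡k*k m (suc n) {{≢-nonZero (gcd[m,n]≢0 (suc n) m (inj₁ λ ()))}} eq

open ℕ-Squares

open import Data.Nat as ℕ using (ℕ)
import Data.Nat.Properties as ℕ
open import Data.Nat.Induction using (<-rec)
open import Data.Integer using (ℤ; +_; -[1+_]; _+_; _*_; -_; _-_; ∣_∣)
import Data.Integer.Properties as ℤ
open import Data.Integer.Tactic.RingSolver using (solve-∀; solve)

‖_‖ℕ² : ℤ³ → ℕ
‖ (x , y , z) ‖ℕ² = ∣ x ∣ ℕ.* ∣ x ∣ ℕ.+ ∣ y ∣ ℕ.* ∣ y ∣ ℕ.+ ∣ z ∣ ℕ.* ∣ z ∣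

i*i≡+∣i∣*∣i∣ : ∀ i → i * i ≡ + (∣ i ∣ ℕ.* ∣ i ∣)
i*i≡+∣i∣*∣i∣ (+ n)    = sym (ℤ.pos-* n n)
i*i≡+∣i∣*∣i∣ -[1+ n ] = refl

‖x‖²≡+‖x‖ℕ² : ∀ x → ‖ x ‖² ≡ + ‖ x ‖ℕ²
‖x‖²≡+‖x‖ℕ² (x , y , z) = begin
  x * x + y * y + z * z
    ≡⟨ cong₂ _+_ (cong₂ _+_ (i*i≡+∣i∣*∣i∣ x) (i*i≡+∣i∣*∣i∣ y)) (i*i≡+∣i∣*∣i∣ z) ⟩
  + (∣ x ∣ ℕ.* ∣ x ∣) + + (∣ y ∣ ℕ.* ∣ y ∣) + + (∣ z ∣ ℕ.* ∣ z ∣)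
    ≡⟨ cong (_+ + (∣ z ∣ ℕ.* ∣ z ∣)) (ℤ.pos-+ (∣ x ∣ ℕ.* ∣ x ∣) (∣ y ∣ ℕ.* ∣ y ∣)) ⟨
  + (∣ x ∣ ℕ.* ∣ x ∣ ℕ.+ ∣ y ∣ ℕ.* ∣ y ∣) + + (∣ z ∣ ℕ.* ∣ z ∣)
    ≡⟨ ℤ.pos-+ (∣ x ∣ ℕ.* ∣ x ∣ ℕ.+ ∣ y ∣ ℕ.* ∣ y ∣) (∣ z ∣ ℕ.* ∣ z ∣) ⟨
  + ‖ (x , y , z) ‖ℕ² ∎
  where open ≡-Reasoning

‖x‖²≡n*n⇒‖x‖ℕ²≡n*n : ∀ x n → ‖ x ‖² ≡ + n * + n → ‖ x ‖ℕ² ≡ n ℕ.* n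
‖x‖²≡n*n⇒‖x‖ℕ²≡n*n x n eq = ℤ.+-injective (trans (sym (‖x‖²≡+‖x‖ℕ² x)) (trans eq (sym (ℤ.pos-* n n))))

‖x‖ℕ²≡n*n⇒‖x‖²≡n*n : ∀ x n → ‖ x ‖ℕ² ≡ n ℕ.* n → ‖ x ‖² ≡ + n * + n
‖x‖ℕ²≡n*n⇒‖x‖²≡n*n x n eq = trans (‖x‖²≡+‖x‖ℕ² x) (trans (cong +_ eq) (ℤ.pos-* n n))

‖x‖²≡0⇒x≡𝟎 : ∀ x → ‖ x ‖² ≡ + 0 → x ≡ 𝟎
‖x‖²≡0⇒x≡𝟎 (x , y , z) eq = cong₂ _,_ (square≡0 x x²≡0) (cong₂ _,_ (square≡0 y y²≡0) (square≡0 z z²≡0))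
  where
  sum≡0 = ‖x‖²≡n*n⇒‖x‖ℕ²≡n*n (x , y , z) 0 eq
  x²+y²≡0 = ℕ.m+n≡0⇒m≡0 _ sum≡0
  x²≡0 = ℕ.m+n≡0⇒m≡0 _ x²+y²≡0
  y²≡0 = ℕ.m+n≡0⇒n≡0 (∣ x ∣ ℕ.* ∣ x ∣) x²+y²≡0
  z²≡0 = ℕ.m+n≡0⇒n≡0 (∣ x ∣ ℕ.* ∣ x ∣ ℕ.+ ∣ y ∣ ℕ.* ∣ y ∣) sum≡0
  square≡0 : ∀ i → ∣ i ∣ ℕ.* ∣ i ∣ ≡ 0 → i ≡ + 0
  square≡0 i e = ℤ.∣i∣≡0⇒i≡0 (m*m≡n*n⇒m≡n {n = 0} e)

mkIsIcube : ∀ {u v w} → u ≢ 𝟎 → u · v ≡ + 0 → u · w ≡ + 0 → v · w ≡ + 0 →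
            ‖ u ‖² ≡ ‖ v ‖² → ‖ u ‖² ≡ ‖ w ‖² → IsIcube u v w
mkIsIcube {u} u≢0 u⊥v u⊥w v⊥w ‖u‖≡‖v‖ ‖u‖≡‖w‖ = record
  { u≢0 = u≢0 ; v≢0 = nonzero ‖u‖≡‖v‖ ; w≢0 = nonzero ‖u‖≡‖w‖
  ; u⊥v = u⊥v ; u⊥w = u⊥w ; v⊥w = v⊥w
  ; ‖u‖≡‖v‖ = ‖u‖≡‖v‖ ; ‖u‖≡‖w‖ = ‖u‖≡‖w‖
  }
  where
  nonzero : ∀ {x} → ‖ u ‖² ≡ ‖ x ‖² → x ≢ 𝟎
  nonzero eq refl = u≢0 (‖x‖²≡0⇒x≡𝟎 u eq)

record Conformal (k : ℤ) (f : ℤ³ → ℤ³) : Set where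
  field
    scales-· : ∀ x y → f x · f y ≡ k * (x · y)

open Conformal

IsIcube-conformal : ∀ {k f u v w} → Conformal k f → f u ≢ 𝟎 → IsIcube u v w → IsIcube (f u) (f v) (f w)
IsIcube-conformal {k} {f} f-conformal fu≢0 i =
  mkIsIcube fu≢0 (orthogonal u⊥v) (orthogonal u⊥w) (orthogonal v⊥w) (isometric ‖u‖≡‖v‖) (isometric ‖u‖≡‖w‖)
  where
  open IsIcube i
  orthogonal : ∀ {x y} → x · y ≡ + 0 → f x · f y ≡ + 0
  orthogonal {x} {y} eq = trans (scales-· f-conformal x y) (trans (cong (k *_) eq) (ℤ.*-zeroʳ k))
  isometric : ∀ {x y} → ‖ x ‖² ≡ ‖ y ‖² → ‖ f x ‖² ≡ ‖ f y ‖²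
  isometric {x} {y} eq = trans (scales-· f-conformal x x) (trans (cong (k *_) eq) (sym (scales-· f-conformal y y)))

_•_ : ℤ → ℤ³ → ℤ³
m • (x , y , z) = m * x , m * y , m * z

•-conformal : ∀ m → Conformal (m * m) (m •_)
•-conformal m .scales-· (x₁ , x₂ , x₃) (y₁ , y₂ , y₃) = identity m x₁ x₂ x₃ y₁ y₂ y₃
  where
  identity : ∀ m x₁ x₂ x₃ y₁ y₂ y₃ →
    m * x₁ * (m * y₁) + m * x₂ * (m * y₂) + m * x₃ * (m * y₃) ≡ m * m * (x₁ * y₁ + x₂ * y₂ + x₃ * y₃)
  identity = solve-∀

m•𝟎≡𝟎 : ∀ m → m • 𝟎 ≡ 𝟎
m•𝟎≡𝟎 m = cong (λ z → z , z , z) (ℤ.*-zeroʳ m)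

swap₁₂ swap₁₃ : ℤ³ → ℤ³
swap₁₂ (x , y , z) = y , x , z
swap₁₃ (x , y , z) = z , y , x

swap₁₂-conformal : Conformal (+ 1) swap₁₂
swap₁₂-conformal .scales-· (x₁ , x₂ , x₃) (y₁ , y₂ , y₃) = identity x₁ x₂ x₃ y₁ y₂ y₃
  where
  identity : ∀ x₁ x₂ x₃ y₁ y₂ y₃ → x₂ * y₂ + x₁ * y₁ + x₃ * y₃ ≡ + 1 * (x₁ * y₁ + x₂ * y₂ + x₃ * y₃)
  identity = solve-∀

swap₁₃-conformal : Conformal (+ 1) swap₁₃
swap₁₃-conformal .scales-· (x₁ , x₂ , x₃) (y₁ , y₂ , y₃) = identity x₁ x₂ x₃ y₁ y₂ y₃
  where
  identity : ∀ x₁ x₂ x₃ y₁ y₂ y₃ → x₃ * y₃ + x₂ * y₂ + x₁ * y₁ ≡ + 1 * (x₁ * y₁ + x₂ * y₂ + x₃ * y₃)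
  identity = solve-∀

-- Icube vectors have integer length

det : ℤ³ → ℤ³ → ℤ³ → ℤ
det (u₁ , u₂ , u₃) (v₁ , v₂ , v₃) (w₁ , w₂ , w₃) =
  u₁ * (v₂ * w₃ - v₃ * w₂) + u₂ * (v₃ * w₁ - v₁ * w₃) + u₃ * (v₁ * w₂ - v₂ * w₁)

-- gram-det a b c x y z is the determinant of the symmetric matrix [[a, x, y], [x, b, z], [y, z, c]].
gram-det : (a b c x y z : ℤ) → ℤ
gram-det a b c x y z = a * b * c + + 2 * (x * y * z) - a * (z * z) - b * (y * y) - c * (x * x)

det²≡gram-det : ∀ u v w → det u v w * det u v w ≡ gram-det ‖ u ‖² ‖ v ‖² ‖ w ‖² (u · v) (u · w) (v · w)
det²≡gram-det (u₁ , u₂ , u₃) (v₁ , v₂ , v₃) (w₁ , w₂ , w₃) = identity u₁ u₂ u₃ v₁ v₂ v₃ w₁ w₂ w₃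
  where
  identity : ∀ u₁ u₂ u₃ v₁ v₂ v₃ w₁ w₂ w₃ →
    let D  = u₁ * (v₂ * w₃ - v₃ * w₂) + u₂ * (v₃ * w₁ - v₁ * w₃) + u₃ * (v₁ * w₂ - v₂ * w₁)
        uu = u₁ * u₁ + u₂ * u₂ + u₃ * u₃
        vv = v₁ * v₁ + v₂ * v₂ + v₃ * v₃
        ww = w₁ * w₁ + w₂ * w₂ + w₃ * w₃
        uv = u₁ * v₁ + u₂ * v₂ + u₃ * v₃
        uw = u₁ * w₁ + u₂ * w₂ + u₃ * w₃
        vw = v₁ * w₁ + v₂ * w₂ + v₃ * w₃
    in D * D ≡ uu * vv * ww + + 2 * (uv * uw * vw) - uu * (vw * vw) - vv * (uw * uw) - ww * (uv * uv)
  identity = solve-∀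

gram-det-scalar : ∀ n → gram-det n n n (+ 0) (+ 0) (+ 0) ≡ n * (n * n)
gram-det-scalar n = identity n
  where
  identity : ∀ n → n * n * n + + 2 * (+ 0 * + 0 * + 0) - n * (+ 0 * + 0) - n * (+ 0 * + 0) - n * (+ 0 * + 0) ≡ n * (n * n)
  identity = solve-∀

det²-icube : ∀ {u v w} → IsIcube u v w → det u v w * det u v w ≡ ‖ u ‖² * (‖ u ‖² * ‖ u ‖²)
det²-icube {u} {v} {w} i = begin
  det u v w * det u v w
    ≡⟨ det²≡gram-det u v w ⟩
  gram-det ‖ u ‖² ‖ v ‖² ‖ w ‖² (u · v) (u · w) (v · w)
    ≡⟨ cong₂ (λ x y → gram-det ‖ u ‖² x y (u · v) (u · w) (v · w)) (sym ‖u‖≡‖v‖) (sym ‖u‖≡‖w‖) ⟩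
  gram-det ‖ u ‖² ‖ u ‖² ‖ u ‖² (u · v) (u · w) (v · w)
    ≡⟨ cong₂ (λ x y → gram-det ‖ u ‖² ‖ u ‖² ‖ u ‖² x y (v · w)) u⊥v u⊥w ⟩
  gram-det ‖ u ‖² ‖ u ‖² ‖ u ‖² (+ 0) (+ 0) (v · w)
    ≡⟨ cong (gram-det ‖ u ‖² ‖ u ‖² ‖ u ‖² (+ 0) (+ 0)) v⊥w ⟩
  gram-det ‖ u ‖² ‖ u ‖² ‖ u ‖² (+ 0) (+ 0) (+ 0)
    ≡⟨ gram-det-scalar ‖ u ‖² ⟩
  ‖ u ‖² * (‖ u ‖² * ‖ u ‖²) ∎
  where
  open ≡-Reasoning
  open IsIcube i

∣det∣²≡‖u‖ℕ²³ : ∀ {u v w} → IsIcube u v w →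
               ∣ det u v w ∣ ℕ.* ∣ det u v w ∣ ≡ ‖ u ‖ℕ² ℕ.* (‖ u ‖ℕ² ℕ.* ‖ u ‖ℕ²)
∣det∣²≡‖u‖ℕ²³ {u} {v} {w} i = begin
  ∣ D ∣ ℕ.* ∣ D ∣                 ≡⟨ ℤ.abs-* D D ⟨
  ∣ D * D ∣                       ≡⟨ cong ∣_∣ (det²-icube i) ⟩
  ∣ ‖ u ‖² * (‖ u ‖² * ‖ u ‖²) ∣  ≡⟨ cong (λ x → ∣ x * (x * x) ∣) (‖x‖²≡+‖x‖ℕ² u) ⟩
  ∣ + n * (+ n * + n) ∣           ≡⟨ ℤ.abs-* (+ n) (+ n * + n) ⟩
  n ℕ.* ∣ + n * + n ∣             ≡⟨ cong (n ℕ.*_) (ℤ.abs-* (+ n) (+ n)) ⟩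
  n ℕ.* (n ℕ.* n)                 ∎
  where
  open ≡-Reasoning
  n = ‖ u ‖ℕ²
  D = det u v w

HasIntegerLength-resp : ∀ x y → ‖ x ‖² ≡ ‖ y ‖² → HasIntegerLength x → HasIntegerLength y
HasIntegerLength-resp x y ‖x‖≡‖y‖ (k , eq) = k , trans (sym ‖x‖≡‖y‖) eq

‖x‖ℕ²-square⇒HasIntegerLength : ∀ x → ∃[ k ] ‖ x ‖ℕ² ≡ k ℕ.* k → HasIntegerLength x
‖x‖ℕ²-square⇒HasIntegerLength x (k , eq) = k , ‖x‖ℕ²≡n*n⇒‖x‖²≡n*n x k eq

icube⇒HasIntegerLength : ∀ {u v w} → IsIcube u v w → HasIntegerLength u
icube⇒HasIntegerLength {u} {v} {w} i =
  ‖x‖ℕ²-square⇒HasIntegerLength u (m*m≡n*[n*n]⇒square ∣ det u v w ∣ ‖ u ‖ℕ² (∣det∣²≡‖u‖ℕ²³ i))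

InSomeIcube⇒HasIntegerLength : ∀ x → InSomeIcube x → HasIntegerLength x
InSomeIcube⇒HasIntegerLength x (u , v , w , i , inj₁ refl) = icube⇒HasIntegerLength i
InSomeIcube⇒HasIntegerLength x (u , v , w , i , inj₂ (inj₁ refl)) =
  HasIntegerLength-resp u v (IsIcube.‖u‖≡‖v‖ i) (icube⇒HasIntegerLength i)
InSomeIcube⇒HasIntegerLength x (u , v , w , i , inj₂ (inj₂ refl)) =
  HasIntegerLength-resp u w (IsIcube.‖u‖≡‖w‖ i) (icube⇒HasIntegerLength i)

-- Pythagorean quadruples come from quaternions

-- The rows of the rotation matrix of the quaternion q₀ + q₁i + q₂j + q₃k, multiplied by its norm.
row₁ row₂ row₃ : (q₀ q₁ q₂ q₃ : ℤ) → ℤ³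
row₁ q₀ q₁ q₂ q₃ = q₀ * q₀ + q₁ * q₁ - q₂ * q₂ - q₃ * q₃ , + 2 * (q₁ * q₂ + q₀ * q₃) , + 2 * (q₁ * q₃ - q₀ * q₂)
row₂ q₀ q₁ q₂ q₃ = + 2 * (q₁ * q₂ - q₀ * q₃) , q₀ * q₀ - q₁ * q₁ + q₂ * q₂ - q₃ * q₃ , + 2 * (q₂ * q₃ + q₀ * q₁)
row₃ q₀ q₁ q₂ q₃ = + 2 * (q₁ * q₃ + q₀ * q₂) , + 2 * (q₂ * q₃ - q₀ * q₁) , q₀ * q₀ - q₁ * q₁ - q₂ * q₂ + q₃ * q₃

rows-icube : ∀ q₀ q₁ q₂ q₃ → row₁ q₀ q₁ q₂ q₃ ≢ 𝟎 → IsIcube (row₁ q₀ q₁ q₂ q₃) (row₂ q₀ q₁ q₂ q₃) (row₃ q₀ q₁ q₂ q₃)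
rows-icube q₀ q₁ q₂ q₃ r₁≢𝟎 =
  mkIsIcube r₁≢𝟎 (r₁⊥r₂ q₀ q₁ q₂ q₃) (r₁⊥r₃ q₀ q₁ q₂ q₃) (r₂⊥r₃ q₀ q₁ q₂ q₃) (‖r₁‖≡‖r₂‖ q₀ q₁ q₂ q₃) (‖r₁‖≡‖r₃‖ q₀ q₁ q₂ q₃)
  where
  r₁⊥r₂ : ∀ q₀ q₁ q₂ q₃ →
      (q₀ * q₀ + q₁ * q₁ - q₂ * q₂ - q₃ * q₃) * (+ 2 * (q₁ * q₂ - q₀ * q₃))
    + + 2 * (q₁ * q₂ + q₀ * q₃) * (q₀ * q₀ - q₁ * q₁ + q₂ * q₂ - q₃ * q₃)
    + + 2 * (q₁ * q₃ - q₀ * q₂) * (+ 2 * (q₂ * q₃ + q₀ * q₁)) ≡ + 0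
  r₁⊥r₂ = solve-∀
  r₁⊥r₃ : ∀ q₀ q₁ q₂ q₃ →
      (q₀ * q₀ + q₁ * q₁ - q₂ * q₂ - q₃ * q₃) * (+ 2 * (q₁ * q₃ + q₀ * q₂))
    + + 2 * (q₁ * q₂ + q₀ * q₃) * (+ 2 * (q₂ * q₃ - q₀ * q₁))
    + + 2 * (q₁ * q₃ - q₀ * q₂) * (q₀ * q₀ - q₁ * q₁ - q₂ * q₂ + q₃ * q₃) ≡ + 0
  r₁⊥r₃ = solve-∀
  r₂⊥r₃ : ∀ q₀ q₁ q₂ q₃ →
      + 2 * (q₁ * q₂ - q₀ * q₃) * (+ 2 * (q₁ * q₃ + q₀ * q₂))
    + (q₀ * q₀ - q₁ * q₁ + q₂ * q₂ - q₃ * q₃) * (+ 2 * (q₂ * q₃ - q₀ * q₁))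
    + + 2 * (q₂ * q₃ + q₀ * q₁) * (q₀ * q₀ - q₁ * q₁ - q₂ * q₂ + q₃ * q₃) ≡ + 0
  r₂⊥r₃ = solve-∀
  ‖r₁‖≡‖r₂‖ : ∀ q₀ q₁ q₂ q₃ →
      (q₀ * q₀ + q₁ * q₁ - q₂ * q₂ - q₃ * q₃) * (q₀ * q₀ + q₁ * q₁ - q₂ * q₂ - q₃ * q₃)
    + + 2 * (q₁ * q₂ + q₀ * q₃) * (+ 2 * (q₁ * q₂ + q₀ * q₃))
    + + 2 * (q₁ * q₃ - q₀ * q₂) * (+ 2 * (q₁ * q₃ - q₀ * q₂))
    ≡ + 2 * (q₁ * q₂ - q₀ * q₃) * (+ 2 * (q₁ * q₂ - q₀ * q₃))
    + (q₀ * q₀ - q₁ * q₁ + q₂ * q₂ - q₃ * q₃) * (q₀ * q₀ - q₁ * q₁ + q₂ * q₂ - q₃ * q₃)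
    + + 2 * (q₂ * q₃ + q₀ * q₁) * (+ 2 * (q₂ * q₃ + q₀ * q₁))
  ‖r₁‖≡‖r₂‖ = solve-∀
  ‖r₁‖≡‖r₃‖ : ∀ q₀ q₁ q₂ q₃ →
      (q₀ * q₀ + q₁ * q₁ - q₂ * q₂ - q₃ * q₃) * (q₀ * q₀ + q₁ * q₁ - q₂ * q₂ - q₃ * q₃)
    + + 2 * (q₁ * q₂ + q₀ * q₃) * (+ 2 * (q₁ * q₂ + q₀ * q₃))
    + + 2 * (q₁ * q₃ - q₀ * q₂) * (+ 2 * (q₁ * q₃ - q₀ * q₂))
    ≡ + 2 * (q₁ * q₃ + q₀ * q₂) * (+ 2 * (q₁ * q₃ + q₀ * q₂))
    + + 2 * (q₂ * q₃ - q₀ * q₁) * (+ 2 * (q₂ * q₃ - q₀ * q₁))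
    + (q₀ * q₀ - q₁ * q₁ - q₂ * q₂ + q₃ * q₃) * (q₀ * q₀ - q₁ * q₁ - q₂ * q₂ + q₃ * q₃)
  ‖r₁‖≡‖r₃‖ = solve-∀

record QuaternionForm (a b c d : ℤ) : Set where
  constructor quaternionForm
  field
    m q₀ q₁ q₂ q₃ : ℤ
    a≡ : a ≡ m * (q₀ * q₀ + q₁ * q₁ - q₂ * q₂ - q₃ * q₃)
    b≡ : b ≡ m * (+ 2 * (q₁ * q₂ + q₀ * q₃))
    c≡ : c ≡ m * (+ 2 * (q₁ * q₃ - q₀ * q₂))
    d≡ : d ≡ m * (q₀ * q₀ + q₁ * q₁ + q₂ * q₂ + q₃ * q₃)

QuaternionForm-icube : ∀ {a b c d} → QuaternionForm a b c d → (a , b , c) ≢ 𝟎 → ∃[ v ] ∃[ w ] IsIcube (a , b , c) v w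
QuaternionForm-icube (quaternionForm m q₀ q₁ q₂ q₃ refl refl refl _) x≢𝟎 =
  m • row₂ q₀ q₁ q₂ q₃ , m • row₃ q₀ q₁ q₂ q₃ ,
  IsIcube-conformal (•-conformal m) x≢𝟎 (rows-icube q₀ q₁ q₂ q₃ λ r₁≡𝟎 → x≢𝟎 (trans (cong (m •_) r₁≡𝟎) (m•𝟎≡𝟎 m)))

QuaternionForm-axis : ∀ d → QuaternionForm d (+ 0) (+ 0) d
QuaternionForm-axis d = quaternionForm d (+ 1) (+ 0) (+ 0) (+ 0) (solve (d ∷ [])) (solve (d ∷ [])) (solve (d ∷ [])) (solve (d ∷ []))

QuaternionForm-neg₁ : ∀ {a b c d} → QuaternionForm a b c d → QuaternionForm (- a) b c d
QuaternionForm-neg₁ (quaternionForm m q₀ q₁ q₂ q₃ refl refl refl refl) =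
  quaternionForm m q₃ (- q₂) (- q₁) q₀ (solve vs) (solve vs) (solve vs) (solve vs)
  where vs = m ∷ q₀ ∷ q₁ ∷ q₂ ∷ q₃ ∷ []

QuaternionForm-neg₂ : ∀ {a b c d} → QuaternionForm a b c d → QuaternionForm a (- b) c d
QuaternionForm-neg₂ (quaternionForm m q₀ q₁ q₂ q₃ refl refl refl refl) =
  quaternionForm m q₀ (- q₁) q₂ (- q₃) (solve vs) (solve vs) (solve vs) (solve vs)
  where vs = m ∷ q₀ ∷ q₁ ∷ q₂ ∷ q₃ ∷ []

QuaternionForm-neg₃ : ∀ {a b c d} → QuaternionForm a b c d → QuaternionForm a b (- c) d
QuaternionForm-neg₃ (quaternionForm m q₀ q₁ q₂ q₃ refl refl refl refl) =
  quaternionForm m q₀ (- q₁) (- q₂) q₃ (solve vs) (solve vs) (solve vs) (solve vs)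
  where vs = m ∷ q₀ ∷ q₁ ∷ q₂ ∷ q₃ ∷ []

QuaternionForm-barning : ∀ {a b c d s} → QuaternionForm a b c d → a + b + c ≡ s →
                         QuaternionForm (d - s + a) (d - s + b) (d - s + c) (d + d - s)
QuaternionForm-barning (quaternionForm m q₀ q₁ q₂ q₃ refl refl refl refl) refl =
  quaternionForm m (q₀ + q₂ - q₃) (- q₁ + q₂ + q₃) q₃ q₂ (solve vs) (solve vs) (solve vs) (solve vs)
  where vs = m ∷ q₀ ∷ q₁ ∷ q₂ ∷ q₃ ∷ []

-- Swaps are needed: a primitive quadruple has exactly one odd leg, and only the first entry of row₁ can be odd.
Parametrised : ℤ → ℤ → ℤ → ℤ → Set
Parametrised a b c d = QuaternionForm a b c d ⊎ QuaternionForm b a c d ⊎ QuaternionForm c b a d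

Parametrised-cong : ∀ {a b c d a′ b′ c′ d′} → Parametrised a b c d →
                    a ≡ a′ → b ≡ b′ → c ≡ c′ → d ≡ d′ → Parametrised a′ b′ c′ d′
Parametrised-cong p refl refl refl refl = p

Parametrised-neg₁ : ∀ {a b c d} → Parametrised a b c d → Parametrised (- a) b c d
Parametrised-neg₁ (inj₁ p)        = inj₁ (QuaternionForm-neg₁ p)
Parametrised-neg₁ (inj₂ (inj₁ p)) = inj₂ (inj₁ (QuaternionForm-neg₂ p))
Parametrised-neg₁ (inj₂ (inj₂ p)) = inj₂ (inj₂ (QuaternionForm-neg₃ p))

Parametrised-neg₂ : ∀ {a b c d} → Parametrised a b c d → Parametrised a (- b) c d
Parametrised-neg₂ (inj₁ p)        = inj₁ (QuaternionForm-neg₂ p)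
Parametrised-neg₂ (inj₂ (inj₁ p)) = inj₂ (inj₁ (QuaternionForm-neg₁ p))
Parametrised-neg₂ (inj₂ (inj₂ p)) = inj₂ (inj₂ (QuaternionForm-neg₂ p))

Parametrised-neg₃ : ∀ {a b c d} → Parametrised a b c d → Parametrised a b (- c) d
Parametrised-neg₃ (inj₁ p)        = inj₁ (QuaternionForm-neg₃ p)
Parametrised-neg₃ (inj₂ (inj₁ p)) = inj₂ (inj₁ (QuaternionForm-neg₃ p))
Parametrised-neg₃ (inj₂ (inj₂ p)) = inj₂ (inj₂ (QuaternionForm-neg₁ p))

Parametrised-abs : ∀ {a b c d} → Parametrised (+ ∣ a ∣) (+ ∣ b ∣) (+ ∣ c ∣) d → Parametrised a b c d
Parametrised-abs {a} {b} {c} {d} =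
  from-abs (λ a → Parametrised a b c d) Parametrised-neg₁ a ∘
  from-abs (λ b → Parametrised (+ ∣ a ∣) b c d) Parametrised-neg₂ b ∘
  from-abs (λ c → Parametrised (+ ∣ a ∣) (+ ∣ b ∣) c d) Parametrised-neg₃ c
  where
  from-abs : (P : ℤ → Set) → (∀ {i} → P i → P (- i)) → ∀ i → P (+ ∣ i ∣) → P i
  from-abs P neg (+ n)    p = p
  from-abs P neg -[1+ n ] p = neg p

Parametrised-barning : ∀ {a b c d s} → Parametrised a b c d → a + b + c ≡ s →
                       Parametrised (d - s + a) (d - s + b) (d - s + c) (d + d - s)
Parametrised-barning (inj₁ p) eq = inj₁ (QuaternionForm-barning p eq)
Parametrised-barning {a} {b} {c} (inj₂ (inj₁ p)) eq =
  inj₂ (inj₁ (QuaternionForm-barning p (trans (cong (_+ c) (ℤ.+-comm b a)) eq)))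
Parametrised-barning {a} {b} {c} (inj₂ (inj₂ p)) eq =
  inj₂ (inj₂ (QuaternionForm-barning p (trans c+b+a≡a+b+c eq)))
  where
  c+b+a≡a+b+c : c + b + a ≡ a + b + c
  c+b+a≡a+b+c = solve (a ∷ b ∷ c ∷ [])

-- The descent map is an involution.
Parametrised-barning⁻¹ : ∀ a b c d → let s = a + b + c in
                         Parametrised (d - s + a) (d - s + b) (d - s + c) (d + d - s) → Parametrised a b c d
Parametrised-barning⁻¹ a b c d p =
  Parametrised-cong (Parametrised-barning p refl) (involutive a b c d a) (involutive a b c d b) (involutive a b c d c) (involutive-d a b c d)
  where
  involutive : ∀ a b c d x → let s = a + b + c; s′ = (d - s + a) + (d - s + b) + (d - s + c) in
               d + d - s - s′ + (d - s + x) ≡ x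
  involutive = solve-∀
  involutive-d : ∀ a b c d → let s = a + b + c; s′ = (d - s + a) + (d - s + b) + (d - s + c) in
                 (d + d - s) + (d + d - s) - s′ ≡ d
  involutive-d = solve-∀

Parametrised-icube : ∀ {a b c d} → Parametrised a b c d → (a , b , c) ≢ 𝟎 → InSomeIcube (a , b , c)
Parametrised-icube (inj₁ p) x≢𝟎 with QuaternionForm-icube p x≢𝟎
... | v , w , i = _ , v , w , i , inj₁ refl
Parametrised-icube (inj₂ (inj₁ p)) x≢𝟎 with QuaternionForm-icube p (x≢𝟎 ∘ cong swap₁₂)
... | v , w , i = _ , swap₁₂ v , swap₁₂ w , IsIcube-conformal swap₁₂-conformal x≢𝟎 i , inj₁ refl
Parametrised-icube (inj₂ (inj₂ p)) x≢𝟎 with QuaternionForm-icube p (x≢𝟎 ∘ cong swap₁₃)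
... | v , w , i = _ , swap₁₃ v , swap₁₃ w , IsIcube-conformal swap₁₃-conformal x≢𝟎 i , inj₁ refl

barning-sum-of-squares : ∀ a b c d → ‖ (a , b , c) ‖² ≡ d * d → let s = a + b + c in
                         ‖ (d - s + a , d - s + b , d - s + c) ‖² ≡ (d + d - s) * (d + d - s)
barning-sum-of-squares a b c d eq = begin
  ‖ (d - s + a , d - s + b , d - s + c) ‖²                ≡⟨ identity a b c d ⟩
  (d + d - s) * (d + d - s) + (‖ (a , b , c) ‖² - d * d)  ≡⟨ cong (λ t → (d + d - s) * (d + d - s) + (t - d * d)) eq ⟩
  (d + d - s) * (d + d - s) + (d * d - d * d)             ≡⟨ cong (λ t → (d + d - s) * (d + d - s) + t) (ℤ.+-inverseʳ (d * d)) ⟩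
  (d + d - s) * (d + d - s) + + 0                         ≡⟨ ℤ.+-identityʳ _ ⟩
  (d + d - s) * (d + d - s)                               ∎
  where
  open ≡-Reasoning
  s = a + b + c
  identity : ∀ a b c d → let s = a + b + c in
    (d - s + a) * (d - s + a) + (d - s + b) * (d - s + b) + (d - s + c) * (d - s + c)
    ≡ (d + d - s) * (d + d - s) + ((a * a + b * b + c * c) - d * d)
  identity = solve-∀

+[m∸n]≡+m-+n : ∀ {m n} → n ℕ.≤ m → + (m ℕ.∸ n) ≡ + m - + n
+[m∸n]≡+m-+n {m} {n} n≤m = trans (sym (ℤ.⊖-≥ n≤m)) (sym (ℤ.m-n≡m⊖n m n))

Parametrised-descent : ∀ a b c d o → ‖ (a , b , c) ‖² ≡ d * d → o ≡ d + d - (a + b + c) →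
                       (∀ a b c → ‖ (a , b , c) ‖² ≡ o * o → Parametrised a b c o) → Parametrised a b c d
Parametrised-descent a b c d o eq o≡ parametrised-o =
  Parametrised-barning⁻¹ a b c d (subst (Parametrised _ _ _) o≡ (parametrised-o _ _ _ sum≡o²))
  where
  sum≡o² : ‖ (d - (a + b + c) + a , d - (a + b + c) + b , d - (a + b + c) + c) ‖² ≡ o * o
  sum≡o² = trans (barning-sum-of-squares a b c d eq) (sym (cong₂ _*_ o≡ o≡))

ParametrisedQuadruples : ℕ → Set
ParametrisedQuadruples d = ∀ a b c → ‖ (a , b , c) ‖² ≡ + d * + d → Parametrised a b c (+ d)

barning-descent : ∀ {d} → (∀ {o} → o ℕ.< d → ParametrisedQuadruples o) →
                  ∀ a b c → a ℕ.* a ℕ.+ b ℕ.* b ℕ.+ c ℕ.* c ≡ d ℕ.* d → 0 ℕ.< a ℕ.* b ℕ.+ b ℕ.* c ℕ.+ c ℕ.* a →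
                  Parametrised (+ a) (+ b) (+ c) (+ d)
barning-descent {d} below a b c eq P>0 =
  Parametrised-descent (+ a) (+ b) (+ c) (+ d) (+ o) (‖x‖ℕ²≡n*n⇒‖x‖²≡n*n (+ a , + b , + c) d eq) +o≡ (below o<d)
  where
  s = a ℕ.+ b ℕ.+ c
  bounds = barning-bounds a b c d eq P>0
  o = d ℕ.+ d ℕ.∸ s
  o<d : o ℕ.< d
  o<d = subst (o ℕ.<_) (ℕ.m+n∸m≡n d d) (ℕ.∸-monoʳ-< (proj₁ bounds) (proj₂ bounds))
  +o≡ : + o ≡ + d + + d - (+ a + + b + + c)
  +o≡ = trans (+[m∸n]≡+m-+n (proj₂ bounds))
              (cong₂ _-_ (ℤ.pos-+ d d) (trans (ℤ.pos-+ (a ℕ.+ b) c) (cong (_+ + c) (ℤ.pos-+ a b))))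

Parametrised-axis : ∀ {a b c d} → OnAxis a b c d → Parametrised (+ a) (+ b) (+ c) (+ d)
Parametrised-axis (inj₁ (refl , refl , refl))        = inj₁ (QuaternionForm-axis _)
Parametrised-axis (inj₂ (inj₁ (refl , refl , refl))) = inj₂ (inj₁ (QuaternionForm-axis _))
Parametrised-axis (inj₂ (inj₂ (refl , refl , refl))) = inj₂ (inj₂ (QuaternionForm-axis _))

parametrise : ∀ d → ParametrisedQuadruples d
parametrise = <-rec ParametrisedQuadruples λ d below a b c eq →
  let eqℕ = ‖x‖²≡n*n⇒‖x‖ℕ²≡n*n (a , b , c) d eq in
  Parametrised-abs ([ Parametrised-axis , barning-descent below (∣ a ∣) (∣ b ∣) (∣ c ∣) eqℕ ]′
                      (OnAxis⊎products>0 (∣ a ∣) (∣ b ∣) (∣ c ∣) d eqℕ))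

HasIntegerLength⇒InSomeIcube : ∀ x → x ≢ 𝟎 → HasIntegerLength x → InSomeIcube x
HasIntegerLength⇒InSomeIcube (a , b , c) x≢𝟎 (n , eq) = Parametrised-icube (parametrise n a b c eq) x≢𝟎

theorem1p4 : (x : ℤ³) → x ≢ 𝟎 → (InSomeIcube x ⇔ HasIntegerLength x)
theorem1p4 x x≢𝟎 = mk⇔ (InSomeIcube⇒HasIntegerLength x) (HasIntegerLength⇒InSomeIcube x x≢𝟎)
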